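{- For any $\varepsilon>0$, there exists an instance on which the Duo-Halve algorithm incurs amortized recourse strictly greater than $\frac52-\varepsilon$.
   Context: Online vertex cover (vertex-arrival): vertices of an unknown graph arrive one at a time with their edges to previously revealed vertices; the algorithm maintains a set of accepted vertices covering all revealed edges, and may late-accept or late-reject previously revealed vertices, each costing one unit of recourse. Amortized recourse = total number of late operations divided by the number of vertices of the final graph. Duo-Halve algorithm: it maintains a matching $M$ built incrementally (edges never removed); $V_M$ denotes the saturated vertices; vertices outside $V_M$ are always rejected. $e_1,e_2$ denote the most recently and second most recently added matching edges; a matching edge is full if both endpoints are accepted, half otherwise. When a new vertex $v$ arrives: if $v$ has a neighbor $p\notin V_M$ (chosen arbitrarily), $(p,v)$ is added to $M$, the old $e_1$ becomes $e_2$ and $(p,v)$ becomes $e_1$. Then every rejected vertex of $V_M$ adjacent to $v$ not an endpoint of $e_1,e_2$ is late-accepted, and HalveBoth chooses statuses of the endpoints of $e_1,e_2$ among those yielding a valid vertex cover, minimizing the number of accepted endpoints of $e_1,e_2$, with ties broken in favour of accepting fewer endpoints of $e_1$ and then fewer late operations. -}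

module Defs where

open import Data.Nat using (ℕ; zero; suc; _<_; _≤_; _≡ᵇ_)
open import Data.Bool using (Bool; true; false; if_then_else_; _∧_; _∨_; not; _xor_)
open import Data.List using (List; []; _∷_; upTo; length)
open import Data.List.Relation.Unary.All using (All)
open import Data.List.Membership.Propositional using (_∈_)
open import Data.Product using (_×_; _,_)
open import Data.Sum using (_⊎_)
open import Relation.Binary.PropositionalEquality using (_≡_)

-- An instance: the i-th entry is the list of neighbours of vertex i among
-- the previously revealed vertices 0 .. i-1 (vertex i arrives at time i).
Instance : Set
Instance = List (List ℕ)

nbrs : Instance → ℕ → List ℕ
nbrs []       _       = []
nbrs (N ∷ G)  zero    = N
nbrs (N ∷ G)  (suc i) = nbrs G i

WellFormed : Instance → Set
WellFormed G = ∀ i → i < length G → All (λ u → u < i) (nbrs G i)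

Adj : Instance → ℕ → ℕ → ℕ → Set
Adj G k u w = (w < k) × (u ∈ nbrs G w)

Status : Set
Status = ℕ → Bool     -- true = accepted

Cover : Instance → ℕ → Status → Set
Cover G k c = ∀ u w → Adj G k u w → (c u ≡ true) ⊎ (c w ≡ true)

elem : ℕ → List ℕ → Bool
elem u []       = false
elem u (x ∷ xs) = (u ≡ᵇ x) ∨ elem u xs

-- matching, most recently added edge first
Matching : Set
Matching = List (ℕ × ℕ)

endpoints : Matching → List ℕ
endpoints []             = []
endpoints ((a , b) ∷ M)  = a ∷ b ∷ endpoints M

inVM : ℕ → Matching → Bool
inVM u M = elem u (endpoints M)

ends₁ : Matching → List ℕ
ends₁ []            = []
ends₁ ((a , b) ∷ _) = a ∷ b ∷ []

ends₁₂ : Matching → List ℕ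
ends₁₂ []                        = []
ends₁₂ ((a , b) ∷ [])            = a ∷ b ∷ []
ends₁₂ ((a , b) ∷ (c , d) ∷ _)   = a ∷ b ∷ c ∷ d ∷ []

countT : (ℕ → Bool) → List ℕ → ℕ
countT f []       = 0
countT f (x ∷ xs) = if f x then suc (countT f xs) else countT f xs

record State : Set where
  constructor st
  field
    acc : Status
    mat : Matching

open State public

initState : State
initState = st (λ _ → false) []

data NewMatch (N : List ℕ) (v : ℕ) (M : Matching) : Matching → Set where
  addEdge : (p : ℕ) → p ∈ N → inVM p M ≡ false → NewMatch N v M ((p , v) ∷ M)
  noEdge  : All (λ p → inVM p M ≡ true) N → NewMatch N v M M

-- statuses after the late-accept phase (v provisionally rejected)
afterLateAccept : Status → List ℕ → ℕ → Matching → Status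
afterLateAccept acc N v M₁ u =
  if u ≡ᵇ v then false
  else (acc u ∨ (elem u N ∧ (inVM u M₁ ∧ not (elem u (ends₁₂ M₁)))))

LexLe : ℕ × ℕ × ℕ → ℕ × ℕ × ℕ → Set
LexLe (a , b , l) (a' , b' , l') =
  (a < a') ⊎ ((a ≡ a') × ((b < b') ⊎ ((b ≡ b') × (l ≤ l'))))

-- HalveBoth objective: (# accepted endpoints of e₁,e₂, # accepted endpoints of e₁,
--  # late operations among endpoints of e₁,e₂), relative to old statuses acc
hbKey : Status → ℕ → Matching → Status → ℕ × ℕ × ℕ
hbKey acc v M₁ c =
  countT c (ends₁₂ M₁) ,
  countT c (ends₁ M₁) ,
  countT (λ u → not (u ≡ᵇ v) ∧ (c u xor acc u)) (ends₁₂ M₁)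

Admissible : Instance → ℕ → Matching → Status → Status → Set
Admissible G v M₁ acc₁ c =
  (∀ u → elem u (ends₁₂ M₁) ≡ false → c u ≡ acc₁ u) × Cover G (suc v) c

data Step (G : Instance) (v : ℕ) : State → State → ℕ → Set where
  step : ∀ {acc M M₁ acc'} →
    NewMatch (nbrs G v) v M M₁ →
    Admissible G v M₁ (afterLateAccept acc (nbrs G v) v M₁) acc' →
    (∀ c → Admissible G v M₁ (afterLateAccept acc (nbrs G v) v M₁) c →
       LexLe (hbKey acc v M₁ acc') (hbKey acc v M₁ c)) →
    Step G v (st acc M) (st acc' M₁) (countT (λ u → acc' u xor acc u) (upTo v))

data Run (G : Instance) : ℕ → State → ℕ → Set where
  start : Run G 0 initState 0
  next  : ∀ {k s s' r d} → Run G k s r → Step G k s s' d → Run G (suc k) s' (r Data.Nat.+ d)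

-- On the graph where vertex i is joined to i − 1, i − 2, i − 4 and i − 5, every decision Duo-Halve takes on the
-- first 18 vertices is forced: each arriving vertex has at most one unsaturated earlier neighbour, and HalveBoth has a
-- unique optimal choice, found by trying all statuses of the at most four endpoints of e₁ and e₂. So the algorithm has
-- exactly one run on this instance; evaluating it yields 45 late operations on 18 vertices, an amortized recourse of
-- exactly 5/2, which exceeds 5/2 − ε for every ε > 0.

module Submission where

open import Defs
open import Data.Bool using (Bool; true; false; T; not; _∧_; _∨_; _xor_; if_then_else_)
open import Data.Bool.ListAction using (all)
open import Data.Bool.Properties using (T-≡; T-not-≡; T-∧; T-∨; not-injective) renaming (_≟_ to _≟ᵇ_)
open import Data.Empty using (⊥-elim)
open import Data.Integer using (+_)
open import Data.List using (List; []; _∷_; [_]; length; map; _++_; findᵇ; upTo; applyUpTo; filterᵇ)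
open import Data.List.Properties using (length-map; ≡-dec)
open import Data.List.Membership.Propositional using (_∈_)
open import Data.List.Membership.Propositional.Properties using (∈-map⁺; ∈-++⁺ˡ; ∈-++⁺ʳ)
open import Data.List.Relation.Unary.All as All using (All)
open import Data.List.Relation.Unary.All.Properties using (all⁺; all⁻)
open import Data.List.Relation.Unary.Any using (here; there)
open import Data.Maybe using (Maybe; just; nothing; is-just; fromMaybe)
open import Data.Nat using (ℕ; zero; suc; _+_; _∸_; _<_; _≡ᵇ_; _<ᵇ_; _≤ᵇ_; _<?_; _≤?_; _≟_; z<s; s<s)
open import Data.Nat.Properties
  using (≡ᵇ⇒≡; <ᵇ⇒<; +-suc; <-cmp; ≤-total; ≤-refl; m<n⇒m<1+n; n<1+n; m<1+n⇒m<n∨m≡n)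
  renaming (+-identityʳ to ℕ-+-identityʳ)
open import Data.Product using (Σ; ∃; _×_; _,_; proj₁; proj₂)
import Data.Product as Product
open import Data.Rational using (ℚ; _/_; _-_; _*_; 0ℚ; Positive) renaming (_<_ to _<ℚ_)
open import Data.Rational.Properties using (*-monoˡ-<-pos; +-monoʳ-<; neg-antimono-<; +-identityʳ)
open import Data.Sum using (_⊎_; inj₁; inj₂)
import Data.Sum as Sum
open import Data.Unit using (tt)
open import Function using (_∘_)
open import Function.Bundles using (Equivalence)
open import Relation.Binary.Definitions using (tri<; tri≈; tri>)
open import Relation.Binary.PropositionalEquality
  using (_≡_; refl; sym; trans; cong; cong₂; subst; subst₂; _≗_)
open import Relation.Nullary using (Dec; ¬_; contradiction)
open import Relation.Nullary.Decidable using (_×-dec_; _⊎-dec_; ⌊_⌋; isNo; toWitness; toWitnessFalse)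

private
  variable
    X : Set

findᵇ-just : ∀ (p : X → Bool) xs {x} → findᵇ p xs ≡ just x → x ∈ xs × T (p x)
findᵇ-just p (y ∷ ys) eq with p y in py
findᵇ-just p (y ∷ ys) refl | true  = here refl , T-≡ .Equivalence.from py
...                        | false = Product.map₁ there (findᵇ-just p ys eq)

findᵇ-nothing : ∀ (p : X → Bool) xs {x} → findᵇ p xs ≡ nothing → x ∈ xs → p x ≡ false
findᵇ-nothing p (y ∷ ys) eq x∈ with p y in py
findᵇ-nothing p (y ∷ ys) () x∈          | true
findᵇ-nothing p (y ∷ ys) eq (here refl) | false = py
findᵇ-nothing p (y ∷ ys) eq (there x∈)  | false = findᵇ-nothing p ys eq x∈

findᵇ-satisfies : ∀ (p : X → Bool) xs d → T (is-just (findᵇ p xs)) → T (p (fromMaybe d (findᵇ p xs)))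
findᵇ-satisfies p xs d found with findᵇ p xs in eq
... | just x = proj₂ (findᵇ-just p xs eq)

neighboursEarlier? : ℕ → Instance → Bool
neighboursEarlier? i []      = true
neighboursEarlier? i (N ∷ G) = all (_<ᵇ i) N ∧ neighboursEarlier? (suc i) G

neighboursEarlier?-sound : ∀ i G → T (neighboursEarlier? i G) →
                           ∀ j → j < length G → All (_< i + j) (nbrs G j)
neighboursEarlier?-sound i (N ∷ G) earlier zero _ rewrite ℕ-+-identityʳ i =
  All.map (<ᵇ⇒< _ i) (all⁺ (_<ᵇ i) N (proj₁ (T-∧ .Equivalence.to earlier)))
neighboursEarlier?-sound i (N ∷ G) earlier (suc j) (s<s j<n) rewrite +-suc i j =
  neighboursEarlier?-sound (suc i) G (proj₂ (T-∧ .Equivalence.to earlier)) j j<n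

neighboursEarlier?-wellFormed : ∀ G → T (neighboursEarlier? 0 G) → WellFormed G
neighboursEarlier?-wellFormed = neighboursEarlier?-sound 0

cover? : Instance → ℕ → Status → Bool
cover? G zero    c = true
cover? G (suc k) c = cover? G k c ∧ all (λ u → c u ∨ c k) (nbrs G k)

cover?-sound : ∀ G k c → T (cover? G k c) → Cover G k c
cover?-sound G (suc k) c covered u w (w<1+k , u∈) with T-∧ .Equivalence.to covered | m<1+n⇒m<n∨m≡n w<1+k
... | earlier , _    | inj₁ w<k  = cover?-sound G k c earlier u w (w<k , u∈)
... | _ , newEdges   | inj₂ refl =
  Sum.map (T-≡ .Equivalence.to) (T-≡ .Equivalence.to) (T-∨ .Equivalence.to (All.lookup (all⁺ _ _ newEdges) u∈))

cover?-complete : ∀ G k c → Cover G k c → T (cover? G k c)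
cover?-complete G zero    c _       = _
cover?-complete G (suc k) c covered = T-∧ .Equivalence.from
  ( cover?-complete G k c (λ u w (w<k , u∈) → covered u w (m<n⇒m<1+n w<k , u∈))
  , all⁻ _ (All.tabulate λ u∈ → T-∨ .Equivalence.from
      (Sum.map (T-≡ .Equivalence.from) (T-≡ .Equivalence.from) (covered _ k (n<1+n k , u∈)))))

Cover-resp-≗ : ∀ G k {c c′} → c ≗ c′ → Cover G k c → Cover G k c′
Cover-resp-≗ G k c≗c′ covered u w edge =
  Sum.map (trans (sym (c≗c′ u))) (trans (sym (c≗c′ w))) (covered u w edge)

override : List ℕ → List Bool → Status → Status
override []      _        f u = f u
override (x ∷ E) []       f u = f u
override (x ∷ E) (b ∷ bs) f u = if u ≡ᵇ x then b else override E bs f u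

override-outside : ∀ E bs f u → elem u E ≡ false → override E bs f u ≡ f u
override-outside []      _        f u _ = refl
override-outside (x ∷ E) []       f u _ = refl
override-outside (x ∷ E) (b ∷ bs) f u out with u ≡ᵇ x
... | false = override-outside E bs f u out

override-restrict : ∀ E c f u → (elem u E ≡ false → c u ≡ f u) → c u ≡ override E (map c E) f u
override-restrict []      c f u agree = agree refl
override-restrict (x ∷ E) c f u agree with u ≡ᵇ x in u≡ᵇx
... | true  = cong c (≡ᵇ⇒≡ u x (T-≡ .Equivalence.from u≡ᵇx))
... | false = override-restrict E c f u agree

bitLists : ℕ → List (List Bool)
bitLists zero    = [ [] ]
bitLists (suc n) = map (true ∷_) (bitLists n) ++ map (false ∷_) (bitLists n)

∈-bitLists : ∀ bs → bs ∈ bitLists (length bs)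
∈-bitLists []           = here refl
∈-bitLists (true ∷ bs)  = ∈-++⁺ˡ (∈-map⁺ (true ∷_) (∈-bitLists bs))
∈-bitLists (false ∷ bs) = ∈-++⁺ʳ _ (∈-map⁺ (false ∷_) (∈-bitLists bs))

lexLe? : ∀ x y → Dec (LexLe x y)
lexLe? (a , b , l) (a′ , b′ , l′) = a <? a′ ⊎-dec a ≟ a′ ×-dec (b <? b′ ⊎-dec b ≟ b′ ×-dec l ≤? l′)

lexLe-refl : ∀ x → LexLe x x
lexLe-refl (a , b , l) = inj₂ (refl , inj₂ (refl , ≤-refl))

lexLe-total : ∀ x y → LexLe x y ⊎ LexLe y x
lexLe-total (a , b , l) (a′ , b′ , l′) with <-cmp a a′ | <-cmp b b′ | ≤-total l l′
... | tri< a<a′ _ _ | _             | _         = inj₁ (inj₁ a<a′)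
... | tri> _ _ a′<a | _             | _         = inj₂ (inj₁ a′<a)
... | tri≈ _ refl _ | tri< b<b′ _ _ | _         = inj₁ (inj₂ (refl , inj₁ b<b′))
... | tri≈ _ refl _ | tri> _ _ b′<b | _         = inj₂ (inj₂ (refl , inj₁ b′<b))
... | tri≈ _ refl _ | tri≈ _ refl _ | inj₁ l≤l′ = inj₁ (inj₂ (refl , inj₂ (refl , l≤l′)))
... | tri≈ _ refl _ | tri≈ _ refl _ | inj₂ l′≤l = inj₂ (inj₂ (refl , inj₂ (refl , l′≤l)))

countT-cong : ∀ {f g} → f ≗ g → ∀ xs → countT f xs ≡ countT g xs
countT-cong f≗g []       = refl
countT-cong f≗g (x ∷ xs) rewrite f≗g x | countT-cong f≗g xs = refl

hbKey-cong : ∀ {old old′ c c′} v M → old ≗ old′ → c ≗ c′ → hbKey old v M c ≡ hbKey old′ v M c′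
hbKey-cong v M old≗ c≗ =
  cong₂ _,_ (countT-cong c≗ (ends₁₂ M)) (cong₂ _,_ (countT-cong c≗ (ends₁ M))
    (countT-cong (λ u → cong₂ (λ p q → not (u ≡ᵇ v) ∧ (p xor q)) (c≗ u) (old≗ u)) (ends₁₂ M)))

afterLateAccept-cong : ∀ {acc acc′} N v M → acc ≗ acc′ → afterLateAccept acc N v M ≗ afterLateAccept acc′ N v M
afterLateAccept-cong N v M acc≗ u rewrite acc≗ u = refl

Admissible-resp : ∀ G v M {base base′ c} → base ≗ base′ → Admissible G v M base c → Admissible G v M base′ c
Admissible-resp G v M base≗ (unchanged , covered) = (λ u out → trans (unchanged u out) (base≗ u)) , covered

module HalveBoth (G : Instance) (v : ℕ) (M₁ : Matching) (old base : Status) where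

  E : List ℕ
  E = ends₁₂ M₁

  candidate : List Bool → Status
  candidate bs = override E bs base

  key : Status → ℕ × ℕ × ℕ
  key = hbKey old v M₁

  Optimal : Status → Set
  Optimal c = Admissible G v M₁ base c × (∀ c′ → Admissible G v M₁ base c′ → LexLe (key c) (key c′))

  -- An admissible choice differs from base only on E, so it is the candidate of its restriction to E
  -- (candidate-restriction); hence searching bitLists (length E) decides whether a candidate is the unique optimum.
  UniqueMinimiser : List Bool → Set
  UniqueMinimiser bs = Cover G (suc v) (candidate bs) ×
    (∀ bs′ → bs′ ∈ bitLists (length E) → Cover G (suc v) (candidate bs′) →
       bs′ ≡ bs ⊎ ¬ LexLe (key (candidate bs′)) (key (candidate bs)))

  ruledOut? : List Bool → List Bool → Bool
  ruledOut? bs bs′ = not (cover? G (suc v) (candidate bs′))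
                   ∨ ⌊ ≡-dec _≟ᵇ_ bs′ bs ⌋
                   ∨ isNo (lexLe? (key (candidate bs′)) (key (candidate bs)))

  uniqueMinimiser? : List Bool → Bool
  uniqueMinimiser? bs = cover? G (suc v) (candidate bs) ∧ all (ruledOut? bs) (bitLists (length E))

  uniqueMinimiser?-sound : ∀ bs → T (uniqueMinimiser? bs) → UniqueMinimiser bs
  uniqueMinimiser?-sound bs isMin with T-∧ .Equivalence.to isMin
  ... | covered , allRuledOut = cover?-sound G (suc v) (candidate bs) covered , beaten
    where
    beaten : ∀ bs′ → bs′ ∈ bitLists (length E) → Cover G (suc v) (candidate bs′) →
             bs′ ≡ bs ⊎ ¬ LexLe (key (candidate bs′)) (key (candidate bs))
    beaten bs′ bs′∈ covered′ with T-∨ .Equivalence.to (All.lookup (all⁺ (ruledOut? bs) _ allRuledOut) bs′∈)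
    ... | inj₁ uncovered = ⊥-elim (subst T (T-not-≡ .Equivalence.to uncovered) (cover?-complete G (suc v) _ covered′))
    ... | inj₂ rest = Sum.map (toWitness {a? = ≡-dec _≟ᵇ_ bs′ bs})
                              (toWitnessFalse {a? = lexLe? (key (candidate bs′)) (key (candidate bs))})
                              (T-∨ .Equivalence.to rest)

  candidate-admissible : ∀ bs → Cover G (suc v) (candidate bs) → Admissible G v M₁ base (candidate bs)
  candidate-admissible bs covered = override-outside E bs base , covered

  restriction : Status → List Bool
  restriction c = map c E

  restriction-∈ : ∀ c → restriction c ∈ bitLists (length E)
  restriction-∈ c = subst (λ n → restriction c ∈ bitLists n) (length-map c E) (∈-bitLists (restriction c))

  candidate-restriction : ∀ c → Admissible G v M₁ base c → c ≗ candidate (restriction c)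
  candidate-restriction c (unchanged , _) u = override-restrict E c base u (unchanged u)

  key-resp-≗ : ∀ {c c′} → c ≗ c′ → key c ≡ key c′
  key-resp-≗ = hbKey-cong v M₁ (λ _ → refl)

  uniqueMinimiser-dichotomy : ∀ bs c → UniqueMinimiser bs → Admissible G v M₁ base c →
                          c ≗ candidate bs ⊎ ¬ LexLe (key c) (key (candidate bs))
  uniqueMinimiser-dichotomy bs c (_ , unique) admissible@(_ , covers)
    with c≗ ← candidate-restriction c admissible
    with unique (restriction c) (restriction-∈ c) (Cover-resp-≗ G (suc v) c≗ covers)
  ... | inj₁ refl   = inj₁ c≗
  ... | inj₂ beaten = inj₂ (beaten ∘ subst (λ k → LexLe k _) (key-resp-≗ c≗))

  uniqueMinimiser-optimal : ∀ bs → UniqueMinimiser bs → Optimal (candidate bs)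
  uniqueMinimiser-optimal bs isMin@(covered , _) = candidate-admissible bs covered , minimal
    where
    minimal : ∀ c → Admissible G v M₁ base c → LexLe (key (candidate bs)) (key c)
    minimal c admissible with uniqueMinimiser-dichotomy bs c isMin admissible
    ... | inj₁ c≗     = subst (LexLe _) (key-resp-≗ (λ u → sym (c≗ u))) (lexLe-refl _)
    ... | inj₂ beaten = Sum.fromInj₁ (λ le → contradiction le beaten) (lexLe-total _ _)

  optimal-unique : ∀ bs c → UniqueMinimiser bs → Optimal c → c ≗ candidate bs
  optimal-unique bs c isMin@(covered , _) (admissible , minimal)
    with uniqueMinimiser-dichotomy bs c isMin admissible
  ... | inj₁ c≗     = c≗
  ... | inj₂ beaten = contradiction (minimal (candidate bs) (candidate-admissible bs covered)) beaten

Optimal-resp : ∀ G v M {old old′ base base′ c} → old ≗ old′ → base ≗ base′ →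
               HalveBoth.Optimal G v M old base c → HalveBoth.Optimal G v M old′ base′ c
Optimal-resp G v M old≗ base≗ (admissible , minimal) =
  Admissible-resp G v M base≗ admissible ,
  λ c′ admissible′ → subst₂ LexLe (hbKey-cong v M old≗ (λ _ → refl)) (hbKey-cong v M old≗ (λ _ → refl))
                       (minimal c′ (Admissible-resp G v M (λ u → sym (base≗ u)) admissible′))

freeNeighbour : List ℕ → Matching → Maybe ℕ
freeNeighbour N M = findᵇ (λ p → not (inVM p M)) N

addMatchEdge : ℕ → Matching → Maybe ℕ → Matching
addMatchEdge v M nothing  = M
addMatchEdge v M (just p) = (p , v) ∷ M

extendMatching : List ℕ → ℕ → Matching → Matching
extendMatching N v M = addMatchEdge v M (freeNeighbour N M)

onlyFree? : List ℕ → Matching → Maybe ℕ → Bool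
onlyFree? N M nothing  = true
onlyFree? N M (just p) = all (λ q → inVM q M ∨ (q ≡ᵇ p)) N

matchingForced? : List ℕ → Matching → Bool
matchingForced? N M = onlyFree? N M (freeNeighbour N M)

newMatch-extend : ∀ N v M → NewMatch N v M (extendMatching N v M)
newMatch-extend N v M with freeNeighbour N M in found
... | nothing = noEdge (All.tabulate λ p∈ → not-injective (findᵇ-nothing _ N found p∈))
... | just p  = let p∈ , free = findᵇ-just _ N found in addEdge p p∈ (T-not-≡ .Equivalence.to free)

newMatch-forced : ∀ N v M {M₁} → T (matchingForced? N M) → NewMatch N v M M₁ → M₁ ≡ extendMatching N v M
newMatch-forced N v M forced newMatch with freeNeighbour N M in found | newMatch
... | nothing | noEdge _ = refl
... | nothing | addEdge q q∈ free =
  contradiction (trans (sym free) (not-injective (findᵇ-nothing _ N found q∈))) λ ()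
... | just p  | noEdge saturated =
  let p∈ , free = findᵇ-just _ N found in
  contradiction (trans (sym (All.lookup saturated p∈)) (T-not-≡ .Equivalence.to free)) λ ()
... | just p  | addEdge q q∈ free with T-∨ .Equivalence.to (All.lookup (all⁺ _ N forced) q∈)
...   | inj₁ saturated = contradiction (trans (sym free) (T-≡ .Equivalence.to saturated)) λ ()
...   | inj₂ q≡ᵇp rewrite ≡ᵇ⇒≡ q p q≡ᵇp = refl

lateOperations : ℕ → Status → Status → ℕ
lateOperations v old new = countT (λ u → new u xor old u) (upTo v)

lateOperations-cong : ∀ v {old old′ new new′} → old ≗ old′ → new ≗ new′ →
                      lateOperations v old new ≡ lateOperations v old′ new′
lateOperations-cong v old≗ new≗ = countT-cong (λ u → cong₂ _xor_ (new≗ u) (old≗ u)) (upTo v)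

module Simulation (G : Instance) where

  module Arrival (v : ℕ) (s : State) where

    A : Status
    A = acc s

    M : Matching
    M = mat s

    M₁ : Matching
    M₁ = extendMatching (nbrs G v) v M

    open HalveBoth G v M₁ A (afterLateAccept A (nbrs G v) v M₁) public

    choice : Maybe (List Bool)
    choice = findᵇ uniqueMinimiser? (bitLists (length E))

    forced? : Bool
    forced? = matchingForced? (nbrs G v) M ∧ is-just choice

    nextState : State
    nextState = st (candidate (fromMaybe [] choice)) M₁

    chosen-uniqueMinimiser : T (is-just choice) → UniqueMinimiser (fromMaybe [] choice)
    chosen-uniqueMinimiser found =
      uniqueMinimiser?-sound _ (findᵇ-satisfies uniqueMinimiser? (bitLists (length E)) [] found)

    nextState-step : T forced? → Step G v s nextState (lateOperations v A (acc nextState))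
    nextState-step isForced = step (newMatch-extend (nbrs G v) v M) (proj₁ optimal) (proj₂ optimal)
      where
      optimal : Optimal (acc nextState)
      optimal = uniqueMinimiser-optimal _ (chosen-uniqueMinimiser (proj₂ (T-∧ .Equivalence.to isForced)))

    step-unique : ∀ {s′ s″ d} → acc s′ ≗ A → mat s′ ≡ M → T forced? → Step G v s′ s″ d →
                  mat s″ ≡ M₁ × acc s″ ≗ acc nextState × d ≡ lateOperations v A (acc nextState)
    step-unique old≗ refl isForced (step {M₁ = M′} {acc' = new} newMatch admissible minimal) =
      matching , new≗ , lateOperations-cong v old≗ new≗
      where
      matching : M′ ≡ M₁
      matching = newMatch-forced (nbrs G v) v M (proj₁ (T-∧ .Equivalence.to isForced)) newMatch
      -- subst rather than `with refl ←`: with-abstraction over these terms makes checking very slow.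
      new≗ : new ≗ acc nextState
      new≗ = optimal-unique _ _ (chosen-uniqueMinimiser (proj₂ (T-∧ .Equivalence.to isForced)))
               (subst (λ M′ → HalveBoth.Optimal G v M′ A (afterLateAccept A (nbrs G v) v M′) new) matching
                 (Optimal-resp G v M′ old≗ (afterLateAccept-cong (nbrs G v) v M′ old≗) (admissible , minimal)))

  open Arrival using (nextState; forced?)

  -- simState k is passed as one argument so that evaluation shares it; unpacking it into acc and mat at
  -- each level would make evaluation exponential in k.
  simState : ℕ → State
  simState zero    = initState
  simState (suc k) = nextState k (simState k)

  simRecourse : ℕ → ℕ
  simRecourse zero    = 0
  simRecourse (suc k) = simRecourse k + lateOperations k (acc (simState k)) (acc (simState (suc k)))

  forcedUpTo? : ℕ → Bool
  forcedUpTo? zero    = true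
  forcedUpTo? (suc k) = forcedUpTo? k ∧ forced? k (simState k)

  simRun : ∀ k → T (forcedUpTo? k) → Run G k (simState k) (simRecourse k)
  simRun zero    _        = start
  simRun (suc k) isForced =
    let earlier , now = T-∧ .Equivalence.to isForced
    in next (simRun k earlier) (Arrival.nextState-step k (simState k) now)

  run-unique : ∀ {k s r} → T (forcedUpTo? k) → Run G k s r →
               acc s ≗ acc (simState k) × mat s ≡ mat (simState k) × r ≡ simRecourse k
  run-unique _        start = (λ _ → refl) , refl , refl
  run-unique isForced (next {k} run stp) =
    let earlier , now          = T-∧ .Equivalence.to isForced
        acc≗ , mat≡ , r≡       = run-unique earlier run
        mat′≡ , acc′≗ , late≡  = Arrival.step-unique k (simState k) acc≗ mat≡ now stp
    in acc′≗ , mat′≡ , cong₂ _+_ r≡ late≡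

lowerBoundInstance : Instance
lowerBoundInstance = applyUpTo backNeighbours 18
  where
  backNeighbours : ℕ → List ℕ
  backNeighbours i = map (i ∸_) (filterᵇ (_≤ᵇ i) (1 ∷ 2 ∷ 4 ∷ 5 ∷ []))

open Simulation lowerBoundInstance

lowerBound-forced : T (forcedUpTo? 18)
lowerBound-forced = tt

lowerBound-recourse : ∀ {s r} → Run lowerBoundInstance 18 s r → r ≡ 45
lowerBound-recourse run = proj₂ (proj₂ (run-unique lowerBound-forced run))

[p-ε]*r<p*r : ∀ p r .{{_ : Positive r}} {ε} → 0ℚ <ℚ ε → (p - ε) * r <ℚ p * r
[p-ε]*r<p*r p r ε>0 =
  *-monoˡ-<-pos r (subst ((p - _) <ℚ_) (+-identityʳ p) (+-monoʳ-< p (neg-antimono-< ε>0)))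

mainTheorem16 : (ε : ℚ) → 0ℚ <ℚ ε →
    Σ Instance (λ G → WellFormed G × (0 < length G) ×
    (∃ (λ s → ∃ (λ r → Run G (length G) s r))) ×
    (∀ s r → Run G (length G) s r →
    ((+ 5 / 2) - ε) * (+ (length G) / 1) <ℚ (+ r / 1)))
mainTheorem16 ε ε>0 =
  lowerBoundInstance ,
  neighboursEarlier?-wellFormed lowerBoundInstance tt ,
  z<s ,
  (simState 18 , simRecourse 18 , simRun 18 lowerBound-forced) ,
  λ s r run → subst (λ r → ((+ 5 / 2) - ε) * (+ 18 / 1) <ℚ + r / 1) (sym (lowerBound-recourse run))
                    ([p-ε]*r<p*r (+ 5 / 2) (+ 18 / 1) ε>0)
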